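{- For any finite signature $\Sigma$, any $S\subseteq\mathcal I$ and any $v\in\mathcal I$: $v\in(S_c)\downarrow$ if and only if $v_t\in S$.
   Context: $\Sigma$ is a finite set of atoms. A partial interpretation is a map $v:\Sigma\to\{0,1,2\}$; $\mathcal I$ is the set of all of them and $\mathcal I_c$ the set of classical ones (no atom mapped to $1$). For $v\in\mathcal I$, $v_t\in\mathcal I_c$ is defined by $v_t(p)=2$ if $v(p)=1$ and $v_t(p)=v(p)$ otherwise. The order on $\mathcal I$: $u\le v$ iff for every atom $p$, $u(p)\le v(p)$ and ($u(p)=0$ implies $v(p)=0$). For $S\subseteq\mathcal I$: $S_c=S\cap\mathcal I_c$; $S\downarrow=\{u\in\mathcal I:\exists v\in S,\ v\ge u\}$. -}

module Defs where

open import Level using (0ℓ)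
open import Data.Nat using (ℕ)
open import Data.Fin using (Fin; zero; suc) renaming (_≤_ to _≤ᶠ_)
open import Data.Vec using (Vec; lookup; map)
open import Data.Product using (_×_; ∃)
open import Relation.Binary.PropositionalEquality using (_≡_; _≢_)
open import Relation.Unary using (Pred; _∈_; _∩_)

Val : Set
Val = Fin 3

𝟘 𝟙 𝟚 : Val
𝟘 = zero
𝟙 = suc zero
𝟚 = suc (suc zero)

-- A finite signature Σ with n atoms is Fin n; a partial interpretation
-- assigns a value to each atom (stored as a vector indexed by the atoms).
Interp : ℕ → Set
Interp n = Vec Val n

ISet : ℕ → Set₁
ISet n = Pred (Interp n) 0ℓ

Classical : ∀ {n} → ISet n
Classical {n} v = ∀ (p : Fin n) → lookup v p ≢ 𝟙

tval : Val → Val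
tval zero = zero
tval (suc zero) = suc (suc zero)
tval (suc (suc x)) = suc (suc x)

toT : ∀ {n} → Interp n → Interp n
toT v = map tval v

_≤ᴵ_ : ∀ {n} → Interp n → Interp n → Set
_≤ᴵ_ {n} u v = ∀ (p : Fin n) → (lookup u p ≤ᶠ lookup v p) × (lookup u p ≡ 𝟘 → lookup v p ≡ 𝟘)

_ᶜˡ : ∀ {n} → ISet n → ISet n
S ᶜˡ = S ∩ Classical

_↓ : ∀ {n} → ISet n → ISet n
(S ↓) u = ∃ λ v → v ∈ S × u ≤ᴵ v

-- The classical interpretations above v are exactly one, namely v_t: an atom at 0 must stay 0,
-- an atom at 2 must stay 2, and an atom at 1 must rise to 2 because 1 is not allowed.
module Submission where

open import Defs
open import Data.Nat using (ℕ; z≤n; s≤s)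
open import Data.Fin using (Fin; zero; suc) renaming (_≤_ to _≤ᶠ_)
open import Data.Vec using (lookup; map)
open import Data.Vec.Properties using (lookup-map)
open import Data.Vec.Relation.Binary.Pointwise.Extensional using (ext; Pointwise-≡⇒≡)
open import Data.Product using (_,_; _×_)
open import Relation.Unary using (_∈_)
open import Relation.Binary.PropositionalEquality using (_≡_; _≢_; refl; sym; trans; subst)
open import Function.Bundles using (_⇔_; mk⇔)

_≤ⱽ_ : Val → Val → Set
a ≤ⱽ b = (a ≤ᶠ b) × (a ≡ 𝟘 → b ≡ 𝟘)

tval-≢𝟙 : (a : Val) → tval a ≢ 𝟙
tval-≢𝟙 zero ()
tval-≢𝟙 (suc zero) ()
tval-≢𝟙 (suc (suc zero)) ()

≤ⱽ-tval : (a : Val) → a ≤ⱽ tval a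
≤ⱽ-tval zero = z≤n , λ _ → refl
≤ⱽ-tval (suc zero) = s≤s z≤n , λ ()
≤ⱽ-tval (suc (suc zero)) = s≤s (s≤s z≤n) , λ ()

≤ⱽ-≢𝟙⇒≡tval : {a b : Val} → a ≤ⱽ b → b ≢ 𝟙 → b ≡ tval a
≤ⱽ-≢𝟙⇒≡tval {zero} (_ , a≡𝟘⇒b≡𝟘) _ = a≡𝟘⇒b≡𝟘 refl
≤ⱽ-≢𝟙⇒≡tval {suc zero} {zero} (() , _) _
≤ⱽ-≢𝟙⇒≡tval {suc zero} {suc zero} _ b≢𝟙 with () ← b≢𝟙 refl
≤ⱽ-≢𝟙⇒≡tval {suc zero} {suc (suc zero)} _ _ = refl
≤ⱽ-≢𝟙⇒≡tval {suc (suc zero)} {zero} (() , _) _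
≤ⱽ-≢𝟙⇒≡tval {suc (suc zero)} {suc zero} (s≤s () , _) _
≤ⱽ-≢𝟙⇒≡tval {suc (suc zero)} {suc (suc zero)} _ _ = refl

module _ {n : ℕ} where

  lookup-toT : (v : Interp n) (p : Fin n) → lookup (toT v) p ≡ tval (lookup v p)
  lookup-toT v p = lookup-map p tval v

  toT-classical : (v : Interp n) → toT v ∈ Classical
  toT-classical v p rewrite lookup-toT v p = tval-≢𝟙 (lookup v p)

  ≤ᴵ-toT : (v : Interp n) → v ≤ᴵ toT v
  ≤ᴵ-toT v p rewrite lookup-toT v p = ≤ⱽ-tval (lookup v p)

  ≤ᴵ-classical⇒≡toT : {v w : Interp n} → v ≤ᴵ w → w ∈ Classical → w ≡ toT v
  ≤ᴵ-classical⇒≡toT {v} {w} v≤w w-classical = Pointwise-≡⇒≡ (ext λ p →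
    trans (≤ⱽ-≢𝟙⇒≡tval (v≤w p) (w-classical p)) (sym (lookup-toT v p)))

corollary1 : (n : ℕ) (S : ISet n) (v : Interp n) → (v ∈ ((S ᶜˡ) ↓)) ⇔ (toT v ∈ S)
corollary1 n S v = mk⇔ to from
  where
  to : v ∈ ((S ᶜˡ) ↓) → toT v ∈ S
  to (w , (w∈S , w-classical) , v≤w) = subst S (≤ᴵ-classical⇒≡toT v≤w w-classical) w∈S

  from : toT v ∈ S → v ∈ ((S ᶜˡ) ↓)
  from toTv∈S = toT v , (toTv∈S , toT-classical v) , ≤ᴵ-toT v
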